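{- Let $r,m$ and $\alpha>\beta$ be positive integers and let $q$ be any prime power. Let $F(X)=X^r\left(X^{\alpha(q-1)}+X^{\beta(q-1)}+1\right)$ and $G(X)=X^{2\alpha-r}\left(X^{\alpha(q-1)}+X^{(\alpha-\beta)(q-1)}+1\right)$. If $F$ and $G$ are permutation polynomials of $\mathbb{F}_{q^2}$, then $F$ and $G$ are QM equivalent over $\mathbb{F}_{q^2}$.
   Context: Two permutation polynomials $f,g\in\mathbb{F}_{Q}[X]$ of $\mathbb{F}_Q$ are called quasi-multiplicative (QM) equivalent if there exist an integer $1\le d<Q-1$ with $\gcd(d,Q-1)=1$ and elements $\alpha',\beta'\in\mathbb{F}_Q^*$ such that $f(X)=\alpha'\, g(\beta' X^d)$. Here $Q=q^2$. -}

module Defs where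

open import Level using (Level; _⊔_)
open import Algebra.Bundles using (CommutativeRing)
open import Data.Nat using (ℕ; zero; suc; _≤_; _<_; _∸_)
import Data.Nat as ℕ
open import Data.Nat.GCD using (gcd)
open import Data.Nat.Primality using (Prime)
open import Data.Fin using (Fin)
open import Data.Product using (_×_; ∃; ∃₂)
open import Relation.Nullary using (¬_)
open import Relation.Binary.PropositionalEquality using (_≡_)

IsPrimePower : ℕ → Set
IsPrimePower q = ∃₂ λ p k → Prime p × 1 ≤ k × q ≡ p ℕ.^ k

module _ {c ℓ : Level} (R : CommutativeRing c ℓ) where
  open CommutativeRing R

  pow : Carrier → ℕ → Carrier
  pow x zero    = 1#
  pow x (suc n) = x * pow x n

  -- R is a field with exactly Q elements (cardinality up to the ring's ≈)
  record IsFiniteFieldOfOrder (Q : ℕ) : Set (c ⊔ ℓ) where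
    field
      nontrivial : ¬ (0# ≈ 1#)
      inverse    : ∀ x → ¬ (x ≈ 0#) → ∃ λ y → x * y ≈ 1#
      enum       : Fin Q → Carrier
      enum-inj   : ∀ i j → enum i ≈ enum j → i ≡ j
      enum-surj  : ∀ x → ∃ λ i → enum i ≈ x

  IsPermutation : (Carrier → Carrier) → Set (c ⊔ ℓ)
  IsPermutation f = (∀ x y → f x ≈ f y → x ≈ y) × (∀ y → ∃ λ x → f x ≈ y)

  QMEquivalent : ℕ → (Carrier → Carrier) → (Carrier → Carrier) → Set (c ⊔ ℓ)
  QMEquivalent Q f g =
    ∃ λ (d : ℕ) → 1 ≤ d × d < Q ∸ 1 × gcd d (Q ∸ 1) ≡ 1 ×
      (∃₂ λ a b → ¬ (a ≈ 0#) × ¬ (b ≈ 0#) × (∀ x → f x ≈ a * g (b * pow x d)))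

  Fmap : (q r α β : ℕ) → Carrier → Carrier
  Fmap q r α β x =
    pow x r * ((pow x (α ℕ.* (q ∸ 1)) + pow x (β ℕ.* (q ∸ 1))) + 1#)

  -- G(X) = X^{2α-r} (X^{α(q-1)} + X^{(α-β)(q-1)} + 1)   (used with r < 2α)
  Gmap : (q r α β : ℕ) → Carrier → Carrier
  Gmap q r α β x =
    pow x (2 ℕ.* α ∸ r) * ((pow x (α ℕ.* (q ∸ 1)) + pow x ((α ∸ β) ℕ.* (q ∸ 1))) + 1#)

-- Write p = q − 1 and s = 2α − r, so that q² − 1 = p(q + 1) and G(y) = y^s (y^{αp} + y^{(α−β)p} + 1).
-- If F (resp. G) is injective then gcd(r, p) = 1 (resp. gcd(s, p) = 1): a nontrivial i-th root of unity ζ with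
-- i ∣ gcd(r, p) would give F(ζ) = 3 = F(1). Choosing u with s u ≡ 1 (mod p), the exponent d = u α (q + 1) − 1
-- satisfies d ≡ −1 (mod q + 1) and d s ≡ r + αp (mod q² − 1), hence d (s + cp) ≡ r + ep (mod q² − 1) whenever
-- c + e = α. By Fermat's little theorem in 𝔽_{q²} this turns the three monomials of G(x^d) into those of F(x),
-- and d is coprime to q² − 1 because it is coprime to both p (via r) and q + 1.
module Submission where

open import Defs
open import Level using (Level)
open import Algebra.Bundles using (CommutativeRing)
import Algebra.Properties.CommutativeMonoid.Sum as Sum
open import Data.Nat as ℕ using (ℕ; zero; suc; NonZero; NonTrivial; _∸_)
import Data.Nat.Properties as ℕ
open import Data.Nat.DivMod using (_%_; _/_; m%n<n; m≡m%n+[m/n]*n)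
open import Data.Nat.Divisibility
  using (_∣_; divides; ∣-trans; 0∣⇒≡0; ∣m∣n⇒∣m+n; ∣n⇒∣m*n; m∣m*n; n∣m*n; quotient≢0; quotient-<)
open import Data.Nat.Coprimality using (Coprime; coprime⇒gcd≡1)
open import Data.Nat.Primality using (prime⇒nonTrivial)
open import Data.Fin as Fin using (Fin)
import Data.Fin.Properties as Fin
open import Data.Fin.Permutation using (Permutation; permutation)
open import Data.List using (List; []; _∷_; length)
open import Data.Product using (∃; ∃₂; _×_; _,_; proj₁; proj₂)
open import Relation.Nullary using (¬_; yes; no; contradiction)
open import Relation.Binary.Definitions using (Decidable)
open import Relation.Binary.PropositionalEquality as ≡ using (_≡_; _≢_)

module _ where
  open import Data.Nat
  open import Data.Nat.Properties
  open import Data.Nat.Divisibility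
  open import Data.Nat.Coprimality using (coprime-Bézout; coprime-divisor)
  open import Data.Nat.GCD using (module Bézout)
  open import Data.Nat.Tactic.RingSolver using (solve-∀)
  open import Relation.Binary.PropositionalEquality
  open ≡-Reasoning

  coprime-* : ∀ {m n o} → Coprime m n → Coprime m o → Coprime m (n * o)
  coprime-* {m} {n} {o} m⊥n m⊥o {i} (i∣m , i∣n*o) =
    m⊥n (i∣m , coprime-divisor i⊥o (subst (i ∣_) (*-comm n o) i∣n*o))
    where
    i⊥o : Coprime i o
    i⊥o (k∣i , k∣o) = m⊥o (∣-trans k∣i i∣m , k∣o)

  coprime-% : ∀ {m} n .{{_ : NonZero n}} → Coprime m n → Coprime (m % n) n
  coprime-% n m⊥n (i∣m%n , i∣n) = m⊥n (∣n∣m%n⇒∣m i∣n i∣m%n , i∣n)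

  coprime⇒nonZero : ∀ {m n} → Coprime m n → n ≢ 1 → NonZero m
  coprime⇒nonZero {n = n} m⊥n n≢1 = ≢-nonZero λ { refl → n≢1 (m⊥n (n ∣0 , ∣-refl)) }

  modular-inverse : ∀ s p .{{_ : NonZero s}} .{{_ : NonZero p}} → Coprime s p →
                    ∃₂ λ u j → s * u ≡ 1 + j * p
  modular-inverse s p s⊥p with coprime-Bézout s⊥p
  ... | Bézout.+- x y 1+yp≡xs = x , y , trans (*-comm s x) (sym 1+yp≡xs)
  -- From 1 + x s = y p: s (x (p − 1) + p) = (y p − 1)(p − 1) + s p ≡ 1 (mod p).
  modular-inverse s@(suc s′) p@(suc p′) s⊥p | Bézout.-+ x y 1+xs≡yp =
    x * p′ + p , y * p′ + s′ , +-cancelʳ-≡ p′ _ _ (begin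
      s * (x * p′ + p) + p′       ≡⟨ expand x s′ p′ ⟩
      p′ * (1 + x * s) + s * p    ≡⟨ cong (λ t → p′ * t + s * p) 1+xs≡yp ⟩
      p′ * (y * p) + s * p        ≡⟨ collect y s′ p′ ⟩
      1 + (y * p′ + s′) * p + p′  ∎)
    where
    expand : ∀ x s′ p′ → suc s′ * (x * p′ + suc p′) + p′ ≡ p′ * (1 + x * suc s′) + suc s′ * suc p′
    expand = solve-∀
    collect : ∀ y s′ p′ → p′ * (y * suc p′) + suc s′ * suc p′ ≡ 1 + (y * p′ + s′) * suc p′ + p′
    collect = solve-∀

  exponent-congruence : ∀ {p r s α u j d} →
    s * u ≡ 1 + j * p → suc d ≡ u * α * suc (suc p) → s + r ≡ α + α →
    ∀ c e → c + e ≡ α → d * (c * p + s) ≡ (j * α + u * α * c) * (p * suc (suc p)) + (e * p + r)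
  exponent-congruence {p} {r} {s} {α} {u} {j} {d} su≡1+jp 1+d≡K s+r≡α+α c e c+e≡α =
    +-cancelˡ-≡ (c * p + s) _ _ (begin
      suc d * (c * p + s)                             ≡⟨ cong (_* (c * p + s)) 1+d≡K ⟩
      u * α * suc (suc p) * (c * p + s)               ≡⟨ split u α p c s ⟩
      s * u * (α * suc (suc p)) + u * α * c * N
        ≡⟨ cong (λ t → t * (α * suc (suc p)) + u * α * c * N) su≡1+jp ⟩
      (1 + j * p) * (α * suc (suc p)) + u * α * c * N ≡⟨ regroup j p α u c ⟩
      (α + α) + α * p + (j * α + u * α * c) * N
        ≡⟨ cong₂ (λ a b → a + b * p + (j * α + u * α * c) * N) (sym s+r≡α+α) (sym c+e≡α) ⟩
      (s + r) + (c + e) * p + (j * α + u * α * c) * N ≡⟨ sort s r c e p _ ⟩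
      (c * p + s) + ((j * α + u * α * c) * N + (e * p + r)) ∎)
    where
    N = p * suc (suc p)
    split : ∀ u α p c s →
      u * α * suc (suc p) * (c * p + s) ≡ s * u * (α * suc (suc p)) + u * α * c * (p * suc (suc p))
    split = solve-∀
    regroup : ∀ j p α u c → (1 + j * p) * (α * suc (suc p)) + u * α * c * (p * suc (suc p)) ≡
                            (α + α) + α * p + (j * α + u * α * c) * (p * suc (suc p))
    regroup = solve-∀
    sort : ∀ s r c e p t → (s + r) + (c + e) * p + t ≡ (c * p + s) + (t + (e * p + r))
    sort = solve-∀

  qm-exponent : ∀ p r s α .{{_ : NonZero p}} .{{_ : NonZero s}} .{{_ : NonZero α}} →
                Coprime r p → Coprime s p → s + r ≡ α + α →
                ∃ λ d → Coprime d (p * suc (suc p)) ×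
                  (∀ c e → c + e ≡ α → ∃ λ t → d * (c * p + s) ≡ t * (p * suc (suc p)) + (e * p + r))
  qm-exponent p r s α r⊥p s⊥p s+r≡α+α with modular-inverse s p s⊥p
  ... | u , j , su≡1+jp = d , coprime-* d⊥p d⊥p+2 , λ c e c+e≡α → j * α + u * α * c , congruence c e c+e≡α
    where
    instance
      u≢0 : NonZero u
      u≢0 = ≢-nonZero λ { refl → 0≢1+n (trans (sym (*-zeroʳ s)) su≡1+jp) }
      uα≢0 : NonZero (u * α)
      uα≢0 = m*n≢0 u α
      K≢0 : NonZero (u * α * suc (suc p))
      K≢0 = m*n≢0 (u * α) (suc (suc p))
    d = pred (u * α * suc (suc p))
    1+d≡K : suc d ≡ u * α * suc (suc p)
    1+d≡K = suc-pred (u * α * suc (suc p))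
    congruence = exponent-congruence {p} {r} {s} {α} {u} {j} {d} su≡1+jp 1+d≡K s+r≡α+α
    d⊥p : Coprime d p
    d⊥p {i} (i∣d , i∣p) = r⊥p (i∣r , i∣p)
      where
      i∣αp+r : i ∣ α * p + r
      i∣αp+r = ∣m+n∣m⇒∣n (subst (i ∣_) (congruence 0 α refl) (∣m⇒∣m*n s i∣d))
                          (∣n⇒∣m*n (j * α + u * α * 0) (∣m⇒∣m*n (suc (suc p)) i∣p))
      i∣r : i ∣ r
      i∣r = ∣m+n∣m⇒∣n i∣αp+r (∣n⇒∣m*n α i∣p)
    d⊥p+2 : Coprime d (suc (suc p))
    d⊥p+2 {i} (i∣d , i∣p+2) =
      ∣1⇒≡1 (∣m+n∣m⇒∣n (subst (i ∣_) (sym (trans (+-comm d 1) 1+d≡K)) (∣n⇒∣m*n (u * α) i∣p+2)) i∣d)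

module _ {c ℓ : Level} (R : CommutativeRing c ℓ) where
  open CommutativeRing R
  open import Algebra.Properties.Semiring.Exp semiring using (_^_; ^-congˡ; ^-homo-*; ^-assocʳ)
  open import Relation.Binary.Reasoning.Setoid setoid

  pow≡^ : ∀ x n → pow R x n ≡ x ^ n
  pow≡^ x zero    = ≡.refl
  pow≡^ x (suc n) = ≡.cong (x *_) (pow≡^ x n)

  1^n≈1 : ∀ n → 1# ^ n ≈ 1#
  1^n≈1 zero    = refl
  1^n≈1 (suc n) = trans (*-identityˡ _) (1^n≈1 n)

  x≈0⇒x^n≈0 : ∀ {x} n .{{_ : NonZero n}} → x ≈ 0# → x ^ n ≈ 0#
  x≈0⇒x^n≈0 (suc n) x≈0 = trans (*-congʳ x≈0) (zeroˡ _)

  ^≈1-∣ : ∀ {x m n} → x ^ m ≈ 1# → m ∣ n → x ^ n ≈ 1#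
  ^≈1-∣ {x} {m} xᵐ≈1 (divides k ≡.refl) = begin
    x ^ (k ℕ.* m)   ≡⟨ ≡.cong (x ^_) (ℕ.*-comm k m) ⟩
    x ^ (m ℕ.* k)   ≈⟨ ^-assocʳ x m k ⟨
    (x ^ m) ^ k     ≈⟨ ^-congˡ k xᵐ≈1 ⟩
    1# ^ k          ≈⟨ 1^n≈1 k ⟩
    1#              ∎

  Fmap-expand : ∀ q e a b x →
    Fmap R q e a b x ≈ (x ^ (a ℕ.* (q ∸ 1) ℕ.+ e) + x ^ (b ℕ.* (q ∸ 1) ℕ.+ e)) + x ^ e
  Fmap-expand q e a b x = begin
    Fmap R q e a b x
      ≡⟨ ≡.cong₂ _*_ (pow≡^ x e) (≡.cong₂ (λ u v → (u + v) + 1#) (pow≡^ x A) (pow≡^ x B)) ⟩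
    x ^ e * ((x ^ A + x ^ B) + 1#)           ≈⟨ distribˡ _ _ _ ⟩
    x ^ e * (x ^ A + x ^ B) + x ^ e * 1#     ≈⟨ +-cong (distribˡ _ _ _) (*-identityʳ _) ⟩
    (x ^ e * x ^ A + x ^ e * x ^ B) + x ^ e  ≈⟨ +-congʳ (+-cong (absorb A) (absorb B)) ⟩
    (x ^ (A ℕ.+ e) + x ^ (B ℕ.+ e)) + x ^ e  ∎
    where
    A = a ℕ.* (q ∸ 1)
    B = b ℕ.* (q ∸ 1)
    absorb : ∀ k → x ^ e * x ^ k ≈ x ^ (k ℕ.+ e)
    absorb k = trans (*-comm _ _) (sym (^-homo-* x k e))

  Fmap-cong : ∀ q e a b {x y} → x ≈ y → Fmap R q e a b x ≈ Fmap R q e a b y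
  Fmap-cong q e a b {x} {y} x≈y = begin
    Fmap R q e a b x                                                 ≈⟨ Fmap-expand q e a b x ⟩
    (x ^ (a ℕ.* (q ∸ 1) ℕ.+ e) + x ^ (b ℕ.* (q ∸ 1) ℕ.+ e)) + x ^ e
      ≈⟨ +-cong (+-cong (^-congˡ (a ℕ.* (q ∸ 1) ℕ.+ e) x≈y) (^-congˡ (b ℕ.* (q ∸ 1) ℕ.+ e) x≈y)) (^-congˡ e x≈y) ⟩
    (y ^ (a ℕ.* (q ∸ 1) ℕ.+ e) + y ^ (b ℕ.* (q ∸ 1) ℕ.+ e)) + y ^ e  ≈⟨ Fmap-expand q e a b y ⟨
    Fmap R q e a b y                                                 ∎

  Fmap-zero : ∀ q e a b {x} .{{_ : NonZero e}} → x ≈ 0# → Fmap R q e a b x ≈ 0#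
  Fmap-zero q e a b {x} x≈0 = begin
    pow R x e * t  ≡⟨ ≡.cong (_* t) (pow≡^ x e) ⟩
    x ^ e * t      ≈⟨ *-congʳ (x≈0⇒x^n≈0 e x≈0) ⟩
    0# * t         ≈⟨ zeroˡ t ⟩
    0#             ∎
    where t = (pow R x (a ℕ.* (q ∸ 1)) + pow R x (b ℕ.* (q ∸ 1))) + 1#

  Fmap-root-of-unity : ∀ p e a b {ζ i} → ζ ^ i ≈ 1# → i ∣ e → i ∣ p →
                       Fmap R (suc p) e a b ζ ≈ Fmap R (suc p) e a b 1#
  Fmap-root-of-unity p e a b {ζ} {i} ζⁱ≈1 i∣e i∣p = begin
    Fmap R (suc p) e a b ζ                                      ≈⟨ Fmap-expand (suc p) e a b ζ ⟩
    (ζ ^ (a ℕ.* p ℕ.+ e) + ζ ^ (b ℕ.* p ℕ.+ e)) + ζ ^ e          ≈⟨ +-cong (+-cong (ζ≈1 a) (ζ≈1 b)) (^≈1-∣ ζⁱ≈1 i∣e) ⟩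
    (1# + 1#) + 1#
      ≈⟨ +-cong (+-cong (1^n≈1 (a ℕ.* p ℕ.+ e)) (1^n≈1 (b ℕ.* p ℕ.+ e))) (1^n≈1 e) ⟨
    (1# ^ (a ℕ.* p ℕ.+ e) + 1# ^ (b ℕ.* p ℕ.+ e)) + 1# ^ e      ≈⟨ Fmap-expand (suc p) e a b 1# ⟨
    Fmap R (suc p) e a b 1#                                     ∎
    where
    ζ≈1 : ∀ k → ζ ^ (k ℕ.* p ℕ.+ e) ≈ 1#
    ζ≈1 k = ^≈1-∣ ζⁱ≈1 (∣m∣n⇒∣m+n (∣n⇒∣m*n k i∣p) i∣e)

  eval : List Carrier → Carrier → Carrier
  eval []       x = 0#
  eval (c ∷ cs) x = c + x * eval cs x

  factor-theorem : ∀ P a → ∃ λ S → length S ≡ ℕ.pred (length P) ×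
                   (∀ x → eval P x ≈ eval P a + (x - a) * eval S x)
  factor-theorem [] a = [] , ≡.refl , λ x → sym (trans (+-identityˡ _) (zeroʳ _))
  factor-theorem (c ∷ []) a = [] , ≡.refl , λ x → begin
    c + x * 0#                  ≈⟨ +-congˡ (trans (zeroʳ x) (sym (zeroʳ a))) ⟩
    c + a * 0#                  ≈⟨ +-identityʳ _ ⟨
    (c + a * 0#) + 0#           ≈⟨ +-congˡ (zeroʳ _) ⟨
    (c + a * 0#) + (x - a) * 0# ∎
  factor-theorem (c ∷ cs@(_ ∷ _)) a with factor-theorem cs a
  ... | S , length-S , cs≈ = eval cs a ∷ S , ≡.cong suc length-S , λ x → begin
    c + x * eval cs x                              ≈⟨ +-congˡ (*-congˡ (cs≈ x)) ⟩
    c + x * (E + (x - a) * eval S x)               ≈⟨ +-congˡ (distribˡ _ _ _) ⟩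
    c + (x * E + x * ((x - a) * eval S x))         ≈⟨ +-congˡ (+-cong (split x) (x-commute x)) ⟩
    c + ((a * E + (x - a) * E) + (x - a) * (x * eval S x)) ≈⟨ +-congˡ (+-assoc _ _ _) ⟩
    c + (a * E + ((x - a) * E + (x - a) * (x * eval S x))) ≈⟨ +-assoc _ _ _ ⟨
    (c + a * E) + ((x - a) * E + (x - a) * (x * eval S x)) ≈⟨ +-congˡ (distribˡ _ _ _) ⟨
    (c + a * E) + (x - a) * (E + x * eval S x)     ∎
    where
    E = eval cs a
    split : ∀ x → x * E ≈ a * E + (x - a) * E
    split x = begin
      x * E                  ≈⟨ *-congʳ (+-identityʳ x) ⟨
      (x + 0#) * E           ≈⟨ *-congʳ (+-congˡ (-‿inverseˡ a)) ⟨
      (x + (- a + a)) * E    ≈⟨ *-congʳ (+-assoc _ _ _) ⟨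
      ((x - a) + a) * E      ≈⟨ distribʳ _ _ _ ⟩
      (x - a) * E + a * E    ≈⟨ +-comm _ _ ⟩
      a * E + (x - a) * E    ∎
    x-commute : ∀ x → x * ((x - a) * eval S x) ≈ (x - a) * (x * eval S x)
    x-commute x = trans (sym (*-assoc _ _ _)) (trans (*-congʳ (*-comm _ _)) (*-assoc _ _ _))

  monomial : ℕ → List Carrier
  monomial zero    = 1# ∷ []
  monomial (suc k) = 0# ∷ monomial k

  length-monomial : ∀ k → length (monomial k) ≡ suc k
  length-monomial zero    = ≡.refl
  length-monomial (suc k) = ≡.cong suc (length-monomial k)

  eval-monomial : ∀ k x → eval (monomial k) x ≈ x ^ k
  eval-monomial zero    x = trans (+-congˡ (zeroʳ x)) (+-identityʳ 1#)
  eval-monomial (suc k) x = trans (+-identityˡ _) (*-congˡ (eval-monomial k x))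

  Xⁿ-1 : ℕ → List Carrier
  Xⁿ-1 zero    = []
  Xⁿ-1 (suc n) = - 1# ∷ monomial n

  length-Xⁿ-1 : ∀ n → length (Xⁿ-1 n) ℕ.≤ suc n
  length-Xⁿ-1 zero    = ℕ.z≤n
  length-Xⁿ-1 (suc n) = ℕ.≤-reflexive (≡.cong suc (length-monomial n))

  eval-Xⁿ-1 : ∀ n x → eval (Xⁿ-1 n) x ≈ x ^ n - 1#
  eval-Xⁿ-1 zero    x = sym (-‿inverseʳ 1#)
  eval-Xⁿ-1 (suc n) x = trans (+-congˡ (*-congˡ (eval-monomial n x))) (+-comm _ _)

  module FiniteField {N : ℕ} (𝔽 : IsFiniteFieldOfOrder R (suc N)) where
    open IsFiniteFieldOfOrder 𝔽
    open import Algebra.Properties.Group +-group using (x∙y⁻¹≈ε⇒x≈y; x≈y⇒x∙y⁻¹≈ε)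
    module ∏ = Sum *-commutativeMonoid

    infix 4 _≈?_
    _≈?_ : Decidable _≈_
    x ≈? y with enum-surj x | enum-surj y
    ... | i , eᵢ≈x | j , eⱼ≈y with i Fin.≟ j
    ... | yes ≡.refl = yes (trans (sym eᵢ≈x) eⱼ≈y)
    ... | no i≢j     = no λ x≈y → i≢j (enum-inj i j (trans eᵢ≈x (trans x≈y (sym eⱼ≈y))))

    1≉0 : ¬ 1# ≈ 0#
    1≉0 1≈0 = nontrivial (sym 1≈0)

    *-cancelʳ : ∀ {x y z} → ¬ z ≈ 0# → x * z ≈ y * z → x ≈ y
    *-cancelʳ {x} {y} {z} z≉0 xz≈yz = begin
      x              ≈⟨ *-identityʳ x ⟨
      x * 1#         ≈⟨ *-congˡ zz⁻¹≈1 ⟨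
      x * (z * z⁻¹)  ≈⟨ *-assoc x z z⁻¹ ⟨
      (x * z) * z⁻¹  ≈⟨ *-congʳ xz≈yz ⟩
      (y * z) * z⁻¹  ≈⟨ *-assoc y z z⁻¹ ⟩
      y * (z * z⁻¹)  ≈⟨ *-congˡ zz⁻¹≈1 ⟩
      y * 1#         ≈⟨ *-identityʳ y ⟩
      y              ∎
      where
      z⁻¹ = proj₁ (inverse z z≉0)
      zz⁻¹≈1 = proj₂ (inverse z z≉0)

    no-zero-divisors : ∀ {x y} → ¬ x ≈ 0# → x * y ≈ 0# → y ≈ 0#
    no-zero-divisors {x} {y} x≉0 xy≈0 = *-cancelʳ x≉0 (trans (*-comm y x) (trans xy≈0 (sym (zeroˡ x))))

    *-nonzero : ∀ {x y} → ¬ x ≈ 0# → ¬ y ≈ 0# → ¬ x * y ≈ 0#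
    *-nonzero x≉0 y≉0 xy≈0 = y≉0 (no-zero-divisors x≉0 xy≈0)

    ∏-nonzero : ∀ {n} (f : Fin n → Carrier) → (∀ j → ¬ f j ≈ 0#) → ¬ ∏.sum f ≈ 0#
    ∏-nonzero {zero}  f f≉0 = 1≉0
    ∏-nonzero {suc n} f f≉0 = *-nonzero (f≉0 Fin.zero) (∏-nonzero (λ j → f (Fin.suc j)) (λ j → f≉0 (Fin.suc j)))

    private
      i₀ : Fin (suc N)
      i₀ = proj₁ (enum-surj 0#)

    unit : Fin N → Carrier
    unit j = enum (Fin.punchIn i₀ j)

    unit≉0 : ∀ j → ¬ unit j ≈ 0#
    unit≉0 j uⱼ≈0 = Fin.punchInᵢ≢i i₀ j (enum-inj _ _ (trans uⱼ≈0 (sym (proj₂ (enum-surj 0#)))))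

    unit-injective : ∀ i j → unit i ≈ unit j → i ≡ j
    unit-injective i j uᵢ≈uⱼ = Fin.punchIn-injective i₀ i j (enum-inj _ _ uᵢ≈uⱼ)

    unit-surjective : ∀ {y} → ¬ y ≈ 0# → ∃ λ j → unit j ≈ y
    unit-surjective {y} y≉0 =
      Fin.punchOut i₀≢k , trans (reflexive (≡.cong enum (Fin.punchIn-punchOut i₀≢k))) eₖ≈y
      where
      k = proj₁ (enum-surj y)
      eₖ≈y = proj₂ (enum-surj y)
      i₀≢k : i₀ ≢ k
      i₀≢k i₀≡k = y≉0 (trans (sym eₖ≈y)
        (trans (reflexive (≡.cong enum (≡.sym i₀≡k))) (proj₂ (enum-surj 0#))))

    instance
      N≢0 : NonZero N
      N≢0 = Fin.nonZeroIndex (proj₁ (unit-surjective 1≉0))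

    scale : ∀ {x} → ¬ x ≈ 0# → Fin N → Fin N
    scale x≉0 j = proj₁ (unit-surjective (*-nonzero x≉0 (unit≉0 j)))

    unit-scale : ∀ {x} (x≉0 : ¬ x ≈ 0#) j → unit (scale x≉0 j) ≈ x * unit j
    unit-scale x≉0 j = proj₂ (unit-surjective (*-nonzero x≉0 (unit≉0 j)))

    scale-inverse : ∀ {x y} (x≉0 : ¬ x ≈ 0#) (y≉0 : ¬ y ≈ 0#) → x * y ≈ 1# →
                    ∀ j → scale x≉0 (scale y≉0 j) ≡ j
    scale-inverse {x} {y} x≉0 y≉0 xy≈1 j = unit-injective _ _ (begin
      unit (scale x≉0 (scale y≉0 j))  ≈⟨ unit-scale x≉0 _ ⟩
      x * unit (scale y≉0 j)          ≈⟨ *-congˡ (unit-scale y≉0 j) ⟩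
      x * (y * unit j)                ≈⟨ *-assoc x y _ ⟨
      (x * y) * unit j                ≈⟨ *-congʳ xy≈1 ⟩
      1# * unit j                     ≈⟨ *-identityˡ _ ⟩
      unit j                          ∎)

    scaling : ∀ {x} → ¬ x ≈ 0# → Permutation N N
    scaling {x} x≉0 = permutation (scale x≉0) (scale x⁻¹≉0)
      (scale-inverse x≉0 x⁻¹≉0 xx⁻¹≈1) (scale-inverse x⁻¹≉0 x≉0 (trans (*-comm _ _) xx⁻¹≈1))
      where
      x⁻¹ = proj₁ (inverse x x≉0)
      xx⁻¹≈1 = proj₂ (inverse x x≉0)
      x⁻¹≉0 : ¬ x⁻¹ ≈ 0#
      x⁻¹≉0 x⁻¹≈0 = 1≉0 (trans (sym xx⁻¹≈1) (trans (*-congˡ x⁻¹≈0) (zeroʳ x)))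

    -- Multiplication by x permutes the units, so their product P satisfies P ≈ x ^ N * P.
    x^N≈1 : ∀ {x} → ¬ x ≈ 0# → x ^ N ≈ 1#
    x^N≈1 {x} x≉0 = *-cancelʳ (∏-nonzero unit unit≉0) (begin
      x ^ N * ∏.sum unit                   ≈⟨ *-congʳ (∏.sum-replicate N {x}) ⟨
      ∏.sum {N} (λ _ → x) * ∏.sum unit     ≈⟨ ∏.∑-distrib-+ (λ _ → x) unit ⟨
      ∏.sum (λ j → x * unit j)             ≈⟨ ∏.sum-cong-≋ (unit-scale x≉0) ⟨
      ∏.sum (λ j → unit (scale x≉0 j))     ≈⟨ ∏.sum-permute unit (scaling x≉0) ⟨
      ∏.sum unit                           ≈⟨ *-identityˡ _ ⟨
      1# * ∏.sum unit                      ∎)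

    ^-periodic : ∀ {x} → ¬ x ≈ 0# → ∀ t m → x ^ (t ℕ.* N ℕ.+ m) ≈ x ^ m
    ^-periodic {x} x≉0 t m = begin
      x ^ (t ℕ.* N ℕ.+ m)      ≈⟨ ^-homo-* x (t ℕ.* N) m ⟩
      x ^ (t ℕ.* N) * x ^ m    ≈⟨ *-congʳ (^≈1-∣ (x^N≈1 x≉0) (n∣m*n t)) ⟩
      1# * x ^ m               ≈⟨ *-identityˡ _ ⟩
      x ^ m                    ∎

    ^-%-exponent : ∀ {x} → ¬ x ≈ 0# → ∀ m → x ^ (m % N) ≈ x ^ m
    ^-%-exponent {x} x≉0 m = begin
      x ^ (m % N)                    ≈⟨ ^-periodic x≉0 (m / N) (m % N) ⟨
      x ^ ((m / N) ℕ.* N ℕ.+ m % N)  ≡⟨ ≡.cong (x ^_) (ℕ.+-comm _ (m % N)) ⟩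
      x ^ (m % N ℕ.+ (m / N) ℕ.* N)  ≡⟨ ≡.cong (x ^_) (m≡m%n+[m/n]*n m N) ⟨
      x ^ m                          ∎

    ^-transfer : ∀ {x d m n} t → ¬ x ≈ 0# → d ℕ.* m ≡ t ℕ.* N ℕ.+ n → (x ^ d) ^ m ≈ x ^ n
    ^-transfer {x} {d} {m} {n} t x≉0 dm≡tN+n = begin
      (x ^ d) ^ m          ≈⟨ ^-assocʳ x d m ⟩
      x ^ (d ℕ.* m)        ≡⟨ ≡.cong (x ^_) dm≡tN+n ⟩
      x ^ (t ℕ.* N ℕ.+ n)  ≈⟨ ^-periodic x≉0 t n ⟩
      x ^ n                ∎

    vanishes-everywhere : ∀ k (a : Fin k → Carrier) → (∀ i j → a i ≈ a j → i ≡ j) →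
                          ∀ P → length P ℕ.≤ k → (∀ i → eval P (a i) ≈ 0#) → ∀ x → eval P x ≈ 0#
    vanishes-everywhere zero    a a-inj []    _ _ x = refl
    vanishes-everywhere (suc k) a a-inj P len≤ P≈0 x with factor-theorem P (a Fin.zero)
    ... | S , length-S , P≈ = begin
      eval P x                          ≈⟨ P≈ x ⟩
      eval P a₀ + (x - a₀) * eval S x   ≈⟨ +-cong (P≈0 Fin.zero) (*-congˡ (S≈0 x)) ⟩
      0# + (x - a₀) * 0#                ≈⟨ +-identityˡ _ ⟩
      (x - a₀) * 0#                     ≈⟨ zeroʳ _ ⟩
      0#                                ∎
      where
      a₀ = a Fin.zero
      S-vanishes : ∀ i → eval S (a (Fin.suc i)) ≈ 0#
      S-vanishes i = no-zero-divisors b-a₀≉0 (begin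
        (b - a₀) * eval S b               ≈⟨ +-identityˡ _ ⟨
        0# + (b - a₀) * eval S b          ≈⟨ +-congʳ (P≈0 Fin.zero) ⟨
        eval P a₀ + (b - a₀) * eval S b   ≈⟨ P≈ b ⟨
        eval P b                          ≈⟨ P≈0 (Fin.suc i) ⟩
        0#                                ∎)
        where
        b = a (Fin.suc i)
        b-a₀≉0 : ¬ b - a₀ ≈ 0#
        b-a₀≉0 b-a₀≈0 with () ← a-inj Fin.zero (Fin.suc i) (sym (x∙y⁻¹≈ε⇒x≈y b a₀ b-a₀≈0))
      S≈0 : ∀ y → eval S y ≈ 0#
      S≈0 = vanishes-everywhere k (λ i → a (Fin.suc i)) (λ i j e → Fin.suc-injective (a-inj _ _ e)) S
              (≡.subst (ℕ._≤ k) (≡.sym length-S) (ℕ.pred-mono-≤ len≤)) S-vanishes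

    -- With N = m g, X^m − 1 has fewer than N roots, so some unit u has u^m ≉ 1; take ζ = u^m.
    nontrivial-root-of-unity : ∀ g .{{_ : NonTrivial g}} → g ∣ N → ∃ λ ζ → ¬ ζ ≈ 1# × ζ ^ g ≈ 1#
    nontrivial-root-of-unity g g∣N@(divides m N≡mg) = unit j ^ m , uʲ≉1 , ζ^g≈1
      where
      instance
        m≢0 : NonZero m
        m≢0 = quotient≢0 g∣N
      not-all-roots : ¬ (∀ j → unit j ^ m ≈ 1#)
      not-all-roots all-roots = 1≉0 (trans (sym 0ᵐ≈1) (x≈0⇒x^n≈0 m refl))
        where
        Xᵐ-1≈0 : ∀ x → eval (Xⁿ-1 m) x ≈ 0#
        Xᵐ-1≈0 = vanishes-everywhere N unit unit-injective (Xⁿ-1 m)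
                   (ℕ.≤-trans (length-Xⁿ-1 m) (quotient-< g∣N))
                   (λ j → trans (eval-Xⁿ-1 m (unit j)) (x≈y⇒x∙y⁻¹≈ε (all-roots j)))
        0ᵐ≈1 : 0# ^ m ≈ 1#
        0ᵐ≈1 = x∙y⁻¹≈ε⇒x≈y _ _ (trans (sym (eval-Xⁿ-1 m 0#)) (Xᵐ-1≈0 0#))
      witness = Fin.¬∀⟶∃¬ N (λ j → unit j ^ m ≈ 1#) (λ j → unit j ^ m ≈? 1#) not-all-roots
      j = proj₁ witness
      uʲ≉1 = proj₂ witness
      ζ^g≈1 : (unit j ^ m) ^ g ≈ 1#
      ζ^g≈1 = begin
        (unit j ^ m) ^ g      ≈⟨ ^-assocʳ (unit j) m g ⟩
        unit j ^ (m ℕ.* g)    ≡⟨ ≡.cong (unit j ^_) N≡mg ⟨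
        unit j ^ N            ≈⟨ x^N≈1 (unit≉0 j) ⟩
        1#                    ∎

    Fmap-injective⇒coprime : ∀ p e a b .{{_ : NonZero p}} → p ∣ N →
      (∀ x y → Fmap R (suc p) e a b x ≈ Fmap R (suc p) e a b y → x ≈ y) → Coprime e p
    Fmap-injective⇒coprime p e a b p∣N inj {zero}   (_ , 0∣p) = contradiction (0∣⇒≡0 0∣p) (ℕ.≢-nonZero⁻¹ p)
    Fmap-injective⇒coprime p e a b p∣N inj {suc zero} _         = ≡.refl
    Fmap-injective⇒coprime p e a b p∣N inj {i@(suc (suc _))} (i∣e , i∣p) =
      contradiction (inj ζ 1# (Fmap-root-of-unity p e a b ζⁱ≈1 i∣e i∣p)) ζ≉1
      where
      root = nontrivial-root-of-unity i (∣-trans i∣p p∣N)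
      ζ = proj₁ root
      ζ≉1 = proj₁ (proj₂ root)
      ζⁱ≈1 = proj₂ (proj₂ root)

    -- The three monomials of F(x) are matched with those of G(x ^ d) in reverse order.
    Fmap≈Fmap∘^ : ∀ {p r s α β a} d .{{_ : NonZero r}} .{{_ : NonZero s}} .{{_ : NonZero (d % N)}} →
      β ℕ.+ a ≡ α →
      (∀ c e → c ℕ.+ e ≡ α → ∃ λ t → d ℕ.* (c ℕ.* p ℕ.+ s) ≡ t ℕ.* N ℕ.+ (e ℕ.* p ℕ.+ r)) →
      ∀ x → Fmap R (suc p) r α β x ≈ Fmap R (suc p) s α a (x ^ (d % N))
    Fmap≈Fmap∘^ {p} {r} {s} {α} {β} {a} d β+a≡α congruence x with x ≈? 0#
    ... | yes x≈0 = trans (Fmap-zero (suc p) r α β x≈0) (sym (Fmap-zero (suc p) s α a (x≈0⇒x^n≈0 (d % N) x≈0)))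
    ... | no x≉0  = begin
      Fmap R (suc p) r α β x                                   ≈⟨ Fmap-expand (suc p) r α β x ⟩
      (x ^ (α ℕ.* p ℕ.+ r) + x ^ (β ℕ.* p ℕ.+ r)) + x ^ r
        ≈⟨ +-cong (+-cong (transfer 0 α ≡.refl) (transfer a β a+β≡α)) (transfer α 0 (ℕ.+-identityʳ α)) ⟨
      (y ^ s + y ^ (a ℕ.* p ℕ.+ s)) + y ^ (α ℕ.* p ℕ.+ s)      ≈⟨ reverse _ _ _ ⟩
      (y ^ (α ℕ.* p ℕ.+ s) + y ^ (a ℕ.* p ℕ.+ s)) + y ^ s      ≈⟨ Fmap-expand (suc p) s α a y ⟨
      Fmap R (suc p) s α a y                                   ≈⟨ Fmap-cong (suc p) s α a (^-%-exponent x≉0 d) ⟨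
      Fmap R (suc p) s α a (x ^ (d % N))                       ∎
      where
      y = x ^ d
      a+β≡α = ≡.trans (ℕ.+-comm a β) β+a≡α
      transfer : ∀ c e → c ℕ.+ e ≡ α → y ^ (c ℕ.* p ℕ.+ s) ≈ x ^ (e ℕ.* p ℕ.+ r)
      transfer c e c+e≡α with t , eq ← congruence c e c+e≡α = ^-transfer {d = d} {m = c ℕ.* p ℕ.+ s} t x≉0 eq
      reverse : ∀ u v w → (u + v) + w ≈ (w + v) + u
      reverse u v w = trans (+-comm _ w) (trans (+-congˡ (+-comm u v)) (sym (+-assoc w v u)))

  qm-equivalent : ∀ p .{{_ : NonZero p}} → IsFiniteFieldOfOrder R (suc (p ℕ.* suc (suc p))) →
    ∀ r α β → 1 ℕ.≤ r → β ℕ.< α → r ℕ.< 2 ℕ.* α →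
    IsPermutation R (Fmap R (suc p) r α β) → IsPermutation R (Gmap R (suc p) r α β) →
    QMEquivalent R (suc (p ℕ.* suc (suc p))) (Fmap R (suc p) r α β) (Gmap R (suc p) r α β)
  qm-equivalent p 𝔽 r α β 1≤r β<α r<2α F-perm G-perm =
    d , ℕ.>-nonZero⁻¹ d , m%n<n d₀ N , coprime⇒gcd≡1 d⊥N , 1# , 1# , 1≉0 , 1≉0 , F≈1·G[1·xᵈ]
    where
    open FiniteField 𝔽
    N = p ℕ.* suc (suc p)
    s = 2 ℕ.* α ∸ r
    instance
      r≢0 : NonZero r
      r≢0 = ℕ.>-nonZero 1≤r
      s≢0 : NonZero s
      s≢0 = ℕ.>-nonZero (ℕ.m<n⇒0<n∸m r<2α)
      α≢0 : NonZero α
      α≢0 = ℕ.>-nonZero (ℕ.<-≤-trans (ℕ.s≤s ℕ.z≤n) β<α)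
    s+r≡α+α : s ℕ.+ r ≡ α ℕ.+ α
    s+r≡α+α = ≡.trans (ℕ.m∸n+n≡m (ℕ.<⇒≤ r<2α)) (≡.cong (α ℕ.+_) (ℕ.+-identityʳ α))
    p∣N : p ∣ N
    p∣N = m∣m*n (suc (suc p))
    exponent = qm-exponent p r s α
      (Fmap-injective⇒coprime p r α β p∣N (proj₁ F-perm))
      (Fmap-injective⇒coprime p s α (α ∸ β) p∣N (proj₁ G-perm))
      s+r≡α+α
    d₀ = proj₁ exponent
    d = d₀ % N
    d⊥N : Coprime d N
    d⊥N = coprime-% N (proj₁ (proj₂ exponent))
    N≢1 : N ≢ 1
    N≢1 N≡1 = ℕ.<⇒≢ (ℕ.≤-trans (ℕ.s≤s (ℕ.s≤s ℕ.z≤n)) (ℕ.m≤n*m (suc (suc p)) p)) (≡.sym N≡1)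
    instance
      d≢0 : NonZero d
      d≢0 = coprime⇒nonZero d⊥N N≢1
    G = Gmap R (suc p) r α β
    F≈1·G[1·xᵈ] : ∀ x → Fmap R (suc p) r α β x ≈ 1# * G (1# * pow R x d)
    F≈1·G[1·xᵈ] x = begin
      Fmap R (suc p) r α β x
        ≈⟨ Fmap≈Fmap∘^ {β = β} {a = α ∸ β} d₀ (ℕ.m+[n∸m]≡n (ℕ.<⇒≤ β<α)) (proj₂ (proj₂ exponent)) x ⟩
      G (x ^ d)               ≈⟨ Fmap-cong (suc p) s α (α ∸ β) (trans (*-identityˡ _) (reflexive (pow≡^ x d))) ⟨
      G (1# * pow R x d)      ≈⟨ *-identityˡ _ ⟨
      1# * G (1# * pow R x d) ∎

2≤prime-power : ∀ {q} → IsPrimePower q → 2 ℕ.≤ q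
2≤prime-power (P , zero  , _       , () , _)
2≤prime-power (P , suc k , P-prime , _  , ≡.refl) = ℕ.≤-trans (ℕ.nonTrivial⇒n>1 P) (ℕ.m≤m*n P (P ℕ.^ k))
  where
  instance
    P-nonTrivial : NonTrivial P
    P-nonTrivial = prime⇒nonTrivial P-prime
    P≢0 : NonZero P
    P≢0 = ℕ.nonTrivial⇒nonZero P
    Pᵏ≢0 : NonZero (P ℕ.^ k)
    Pᵏ≢0 = ℕ.m^n≢0 P k

[1+p]²≡1+p[p+2] : ∀ p → suc p ℕ.^ 2 ≡ suc (p ℕ.* suc (suc p))
[1+p]²≡1+p[p+2] p = expand p
  where
  open import Data.Nat.Tactic.RingSolver using (solve-∀)
  expand : ∀ p → suc p ℕ.* (suc p ℕ.* 1) ≡ suc (p ℕ.* suc (suc p))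
  expand = solve-∀

open import Data.Nat using (ℕ; _≤_; _<_; _*_; _^_)

theorem6p2 : ∀ {c ℓ : Level} (R : CommutativeRing c ℓ) (q : ℕ) →
    IsPrimePower q → IsFiniteFieldOfOrder R (q ^ 2) →
    (r α β : ℕ) → 1 ≤ r → 1 ≤ β → β < α → r < 2 * α →
    IsPermutation R (Fmap R q r α β) →
    IsPermutation R (Gmap R q r α β) →
    QMEquivalent R (q ^ 2) (Fmap R q r α β) (Gmap R q r α β)
theorem6p2 R q q-prime-power 𝔽 r α β 1≤r _ β<α r<2α F-perm G-perm with 2≤prime-power q-prime-power
... | ℕ.s≤s (ℕ.s≤s {n = p′} _) =
  ≡.subst (λ Q → QMEquivalent R Q (Fmap R q r α β) (Gmap R q r α β)) (≡.sym q²≡)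
    (qm-equivalent R (suc p′) (≡.subst (IsFiniteFieldOfOrder R) q²≡ 𝔽) r α β 1≤r β<α r<2α F-perm G-perm)
  where
  q²≡ : q ^ 2 ≡ suc (suc p′ * suc q)
  q²≡ = [1+p]²≡1+p[p+2] (suc p′)
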